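{- Let $A$ be a finite set and $(S,\delta)$ a labelled transition system with $\delta\colon S\to(\mathcal{P}_\omega S)^A$. For all $X,Y\in\mathcal{P}_\omega(S)$: $o(X)=o(Y)$ iff $o_1(X)=o_1(Y)$.
   Context: $I(\delta(x))=\{a\in A\mid\delta(x)(a)\neq\emptyset\}$, $Fail(\delta(x))=\{Z\subseteq A\mid Z\cap I(\delta(x))=\emptyset\}$, and $o(X)=\bigcup_{x\in X}Fail(\delta(x))\in\mathcal{P}(\mathcal{P}(A))$. An antichain on $\mathcal{P}(A)$ is a set $I\subseteq\mathcal{P}(A)$ with no $Z,Z'\in I$ such that $Z'\subsetneq Z$; for $I\subseteq\mathcal{P}(A)$, $min(I)=\{Z\in I\mid\neg\exists Z'\in I.\ Z'\subsetneq Z\}$. The map $o_1$ from $\mathcal{P}_\omega(S)$ to antichains is defined by $o_1(\{x\})=\{I(\delta(x))\}$, $o_1(\emptyset)=\emptyset$, $o_1(X_1\cup X_2)=min(o_1(X_1)\cup o_1(X_2))$. -}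

module Defs where

open import Data.Nat using (ℕ)
open import Data.Fin using (Fin)
open import Data.Bool using (not)
open import Data.List using (List; []; _∷_; null)
open import Data.List.Membership.Propositional using (_∈_)
open import Data.Vec using (tabulate)
open import Data.Fin.Subset as Sub using (Subset; _∩_; _⊂_)
open import Data.Product using (_×_; ∃)
open import Data.Sum using (_⊎_)
open import Data.Empty using (⊥)
open import Relation.Nullary using (¬_)
open import Relation.Binary.PropositionalEquality using (_≡_)
open import Relation.Unary using (Pred)
open import Level using (0ℓ)

-- Labelled transition system with finite action set A = Fin n:
-- δ : S → (P_ω S)^A, finite sets of successors represented as lists.
LTS : ℕ → Set → Set
LTS n S = S → Fin n → List S

Family : ℕ → Set₁
Family n = Pred (Subset n) 0ℓ

I : ∀ {n} {S : Set} → LTS n S → S → Subset n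
I δ x = tabulate (λ a → not (null (δ x a)))

Fail : ∀ {n} {S : Set} → LTS n S → S → Family n
Fail δ x Z = Z ∩ I δ x ≡ Sub.⊥

o : ∀ {n} {S : Set} → LTS n S → List S → Family n
o δ X Z = ∃ λ x → x ∈ X × Fail δ x Z

min : ∀ {n} → Family n → Family n
min F Z = F Z × ¬ (∃ λ Z' → F Z' × Z' ⊂ Z)

o₁ : ∀ {n} {S : Set} → LTS n S → List S → Family n
o₁ δ [] Z = ⊥
o₁ δ (x ∷ X) = min (λ Z → Z ≡ I δ x ⊎ o₁ δ X Z)

-- For a finite set X of states write Inits X = { I(δ x) | x ∈ X } ⊆ P(A).
-- A set Z fails from x exactly when I(δ x) ⊆ ∁ Z, so o(X) is the
-- complement-image of the upward closure Up(Inits X); the antichain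
-- o₁(X) is the set of minimal elements min(Inits X).  Since ∁ is an
-- involution, the theorem reduces to: two finite families of subsets of A
-- have the same upward closure iff they have the same minimal elements,
-- which is order theory on the finite lattice of subsets of A.
module Submission where

open import Defs
open import Data.Nat using (ℕ)
open import Data.List using (List; []; _∷_)
-- Inclusion of families is written ⊑ to keep ⊆ for inclusion of subsets.
open import Relation.Unary using (Pred; _≐_; _∪_) renaming (_⊆_ to _⊑_)
open import Function.Bundles using (_⇔_; mk⇔)

open import Data.Fin.Subset as Sub using (Subset; _∩_; _⊂_; _⊆_; ∁)
open import Data.Fin.Subset.Properties
  using ( ⊆-refl; ⊆-trans; ⊆-antisym; ⊆-⊂-trans; _∈?_; _⊂?_
        ; x∉p⇒x∈∁p; x∈p⇒x∉∁p; x∈p∩q⁺; x∈p∩q⁻; ∉⊥; Empty-unique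
        ; ∪-∩-booleanAlgebra )
open import Data.Fin.Subset.Induction using (⊂-wellFounded)
import Algebra.Lattice.Properties.BooleanAlgebra as BooleanAlgebra
open import Induction.WellFounded using (module All)
open import Data.List.Membership.Propositional using (_∈_; find; lose)
open import Data.List.Relation.Unary.Any using (here; there; any?)
open import Data.Product using (∃; _×_; _,_; proj₁)
open import Data.Sum using (inj₁; inj₂)
open import Data.Empty using (⊥-elim)
open import Function.Base using (_∘_)
open import Function.Properties.Equivalence using () renaming (trans to ⇔-trans)
open import Relation.Nullary using (¬_; Dec; yes; no)
open import Relation.Nullary.Decidable using (map′)
open import Relation.Unary.Properties using (≐-sym; ≐-trans)
open import Relation.Binary.PropositionalEquality using (_≡_; refl; sym; subst)
open import Level using (0ℓ)

module Families {n : ℕ} where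

  open BooleanAlgebra (∪-∩-booleanAlgebra n) using (¬-involutive)

  ⊆-¬⊂⇒≡ : {W V : Subset n} → W ⊆ V → ¬ (W ⊂ V) → W ≡ V
  ⊆-¬⊂⇒≡ {W} {V} W⊆V W⊄V = ⊆-antisym W⊆V V⊆W
    where
    V⊆W : V ⊆ W
    V⊆W {i} i∈V with i ∈? W
    ... | yes i∈W = i∈W
    ... | no  i∉W = ⊥-elim (W⊄V (W⊆V , i , i∈V , i∉W))

  disjoint⇒⊆∁ : {Z W : Subset n} → Z ∩ W ≡ Sub.⊥ → W ⊆ ∁ Z
  disjoint⇒⊆∁ {Z} Z∩W≡⊥ {i} i∈W with i ∈? Z
  ... | yes i∈Z = ⊥-elim (∉⊥ (subst (Sub._∈_ i) Z∩W≡⊥ (x∈p∩q⁺ (i∈Z , i∈W))))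
  ... | no  i∉Z = x∉p⇒x∈∁p i∉Z

  ⊆∁⇒disjoint : {Z W : Subset n} → W ⊆ ∁ Z → Z ∩ W ≡ Sub.⊥
  ⊆∁⇒disjoint {Z} {W} W⊆∁Z = Empty-unique λ (i , i∈Z∩W) →
    let i∈Z , i∈W = x∈p∩q⁻ Z W i∈Z∩W in x∈p⇒x∉∁p i∈Z (W⊆∁Z i∈W)

  Up : Family n → Family n
  Up F Z = ∃ λ W → F W × W ⊆ Z

  MinimalBelow : Family n → Set
  MinimalBelow F = ∀ {W} → F W → ∃ λ M → min F M × M ⊆ W

  -- Since ⊂ is well founded on Subset n, minimal members exist below
  -- every member as soon as strict predecessors in F can be detected.
  minimalBelow : (F : Family n) → (∀ W → Dec (∃ λ V → F V × V ⊂ W)) →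
                 MinimalBelow F
  minimalBelow F below? {W} = All.wfRec ⊂-wellFounded 0ℓ P step W
    where
    P : Pred (Subset n) 0ℓ
    P W = F W → ∃ λ M → min F M × M ⊆ W

    step : ∀ W → (∀ {V} → V ⊂ W → P V) → P W
    step W rec FW with below? W
    ... | no  none = W , (FW , none) , ⊆-refl
    ... | yes (V , FV , V⊂W) =
      let M , minM , M⊆V = rec V⊂W FV in M , minM , ⊆-trans M⊆V (proj₁ V⊂W)

  min-from-Up : {F G : Family n} → Up F ⊑ Up G → Up G ⊑ Up F → min F ⊑ min G
  min-from-Up {F} {G} F≤G G≤F {W} (FW , W-minimal) = GW , W-minimalᴳ
    where
    V-below : ∃ λ V → G V × V ⊆ W
    V-below = F≤G (W , FW , ⊆-refl)

    GW : G W
    GW with V-below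
    ... | V , GV , V⊆W with G≤F (V , GV , ⊆-refl)
    ...   | U , FU , U⊆V =
      let U≡W = ⊆-¬⊂⇒≡ (⊆-trans U⊆V V⊆W) (λ U⊂W → W-minimal (U , FU , U⊂W))
          W⊆V = subst (_⊆ V) U≡W U⊆V
      in subst G (⊆-antisym V⊆W W⊆V) GV

    W-minimalᴳ : ¬ (∃ λ V → G V × V ⊂ W)
    W-minimalᴳ (V , GV , V⊂W) with G≤F (V , GV , ⊆-refl)
    ... | U , FU , U⊆V = W-minimal (U , FU , ⊆-⊂-trans U⊆V V⊂W)

  Up-from-min : {F G : Family n} → MinimalBelow F → min F ⊑ min G → Up F ⊑ Up G
  Up-from-min minF F≤G (W , FW , W⊆Z) =
    let M , minM , M⊆W = minF FW in M , proj₁ (F≤G minM) , ⊆-trans M⊆W W⊆Z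

  Up≐⇔min≐ : {F G : Family n} → MinimalBelow F → MinimalBelow G →
             (Up F ≐ Up G) ⇔ (min F ≐ min G)
  Up≐⇔min≐ minF minG = mk⇔
    (λ (F≤G , G≤F) → min-from-Up F≤G G≤F , min-from-Up G≤F F≤G)
    (λ (F≤G , G≤F) → Up-from-min minF F≤G , Up-from-min minG G≤F)

  ∘∁≐⇔≐ : (P Q : Family n) → ((P ∘ ∁) ≐ (Q ∘ ∁)) ⇔ (P ≐ Q)
  ∘∁≐⇔≐ P Q = mk⇔
    (λ (P≤Q , Q≤P) → via {P} {Q} P≤Q , via {Q} {P} Q≤P)
    (λ (P≤Q , Q≤P) → P≤Q , Q≤P)
    where
    via : {R T : Family n} → (R ∘ ∁) ⊑ (T ∘ ∁) → R ⊑ T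
    via {R} {T} R≤T {Z} RZ =
      subst T (¬-involutive Z) (R≤T (subst R (sym (¬-involutive Z)) RZ))

  min-cong : {F G : Family n} → F ≐ G → min F ≐ min G
  min-cong (F≤G , G≤F) =
    (λ (FW , none) → F≤G FW , λ (V , GV , V⊂W) → none (V , G≤F GV , V⊂W)) ,
    (λ (GW , none) → G≤F GW , λ (V , FV , V⊂W) → none (V , F≤G FV , V⊂W))

  ∪-congʳ : (F : Family n) {G H : Family n} → G ≐ H → (F ∪ G) ≐ (F ∪ H)
  ∪-congʳ F (G≤H , H≤G) =
    (λ { (inj₁ FW) → inj₁ FW ; (inj₂ GW) → inj₂ (G≤H GW) }) ,
    (λ { (inj₁ FW) → inj₁ FW ; (inj₂ HW) → inj₂ (H≤G HW) })

  ≐-respects : {P P′ Q Q′ : Family n} → P ≐ P′ → Q ≐ Q′ → (P ≐ Q) ⇔ (P′ ≐ Q′)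
  ≐-respects P≐P′ Q≐Q′ = mk⇔
    (λ P≐Q → ≐-trans (≐-sym P≐P′) (≐-trans P≐Q Q≐Q′))
    (λ P′≐Q′ → ≐-trans P≐P′ (≐-trans P′≐Q′ (≐-sym Q≐Q′)))

  -- Replacing a family by its minimal members before taking the minimum of
  -- a union does not change the result; this is the inductive step of o₁.
  min-∪-min : (F G : Family n) → MinimalBelow G → min (F ∪ min G) ≐ min (F ∪ G)
  min-∪-min F G minG = to , from
    where
    drop-min : (F ∪ min G) ⊑ (F ∪ G)
    drop-min (inj₁ FW)    = inj₁ FW
    drop-min (inj₂ minGW) = inj₂ (proj₁ minGW)

    to : min (F ∪ min G) ⊑ min (F ∪ G)
    to {W} (member , none) = drop-min member , no-strict
      where
      -- a strict predecessor in G would put a minimal one of G below W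
      no-strict : ¬ (∃ λ V → (F ∪ G) V × V ⊂ W)
      no-strict (V , inj₁ FV , V⊂W) = none (V , inj₁ FV , V⊂W)
      no-strict (V , inj₂ GV , V⊂W) =
        let M , minM , M⊆V = minG GV in none (M , inj₂ minM , ⊆-⊂-trans M⊆V V⊂W)

    from : min (F ∪ G) ⊑ min (F ∪ min G)
    from {W} (member , none) =
      minimal-member member , λ (V , V∈ , V⊂W) → none (V , drop-min V∈ , V⊂W)
      where
      minimal-member : (F ∪ G) W → (F ∪ min G) W
      minimal-member (inj₁ FW) = inj₁ FW
      minimal-member (inj₂ GW) = inj₂ (GW , λ (V , GV , V⊂W) → none (V , inj₂ GV , V⊂W))

open Families

module _ {n : ℕ} {S : Set} (δ : LTS n S) where

  Inits : List S → Family n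
  Inits X W = ∃ λ x → x ∈ X × W ≡ I δ x

  -- Inits of a cons, in the shape used by the definition of o₁.
  Inits-∷ : (x : S) (X : List S) → Inits (x ∷ X) ≐ ((_≡ I δ x) ∪ Inits X)
  Inits-∷ x X =
    (λ { (_ , here refl , W≡) → inj₁ W≡ ; (y , there y∈X , W≡) → inj₂ (y , y∈X , W≡) }) ,
    (λ { (inj₁ W≡) → x , here refl , W≡ ; (inj₂ (y , y∈X , W≡)) → y , there y∈X , W≡ })

  -- A finite family: strict predecessors are found by scanning the list.
  Inits-minimalBelow : (X : List S) → MinimalBelow (Inits X)
  Inits-minimalBelow X = minimalBelow (Inits X) below?
    where
    below? : ∀ W → Dec (∃ λ V → Inits X V × V ⊂ W)
    below? W = map′
      (λ any → let x , x∈X , Ix⊂W = find any in I δ x , (x , x∈X , refl) , Ix⊂W)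
      (λ { (_ , (x , x∈X , refl) , Ix⊂W) → lose x∈X Ix⊂W })
      (any? (λ x → I δ x ⊂? W) X)

  o≐Up∘∁ : (X : List S) → o δ X ≐ (Up (Inits X) ∘ ∁)
  o≐Up∘∁ X =
    (λ (x , x∈X , fails) → I δ x , (x , x∈X , refl) , disjoint⇒⊆∁ fails) ,
    (λ { (_ , (x , x∈X , refl) , Ix⊆∁Z) → x , x∈X , ⊆∁⇒disjoint Ix⊆∁Z })

  o₁≐min : (X : List S) → o₁ δ X ≐ min (Inits X)
  o₁≐min [] = (λ ()) , λ { ((_ , () , _) , _) }
  o₁≐min (x ∷ X) =
    ≐-trans (min-cong (∪-congʳ Ix (o₁≐min X))) (
    ≐-trans (min-∪-min Ix (Inits X) (Inits-minimalBelow X))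
            (min-cong (≐-sym (Inits-∷ x X))))
    where
    Ix : Family n
    Ix = _≡ I δ x

proposition4p1 : (n : ℕ) {S : Set} (δ : LTS n S) (X Y : List S) →
    (o δ X ≐ o δ Y) ⇔ (o₁ δ X ≐ o₁ δ Y)
proposition4p1 n δ X Y =
  ⇔-trans (≐-respects (o≐Up∘∁ δ X) (o≐Up∘∁ δ Y)) (
  ⇔-trans (∘∁≐⇔≐ (Up (Inits δ X)) (Up (Inits δ Y))) (
  ⇔-trans (Up≐⇔min≐ (Inits-minimalBelow δ X) (Inits-minimalBelow δ Y))
          (≐-respects (≐-sym (o₁≐min δ X)) (≐-sym (o₁≐min δ Y)))))
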